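{- Let $n$ and $a$ be relatively prime positive integers and $s\ge1$, and assume the Euclidean algorithm with $n$ and $a$ (in the generalized sense described in the context) produces the symmetric sequence of quotients $q_1,\ldots,q_s,q_s,\ldots,q_1$. Then $\frac{a^2+1}{n}$ is an integer, the reduced numerator of the continued fraction $[q_2,\ldots,q_s,q_s,\ldots,q_2]$ equals $\frac{a^2+1}{n}$, and its reduced denominator is the remainder when $a$ is divided by $\frac{a^2+1}{n}$.
   Context: Generalized Euclidean algorithm: for a finite sequence $(u_1,\ldots,u_m)$ ($m\ge0$) of positive integers, define $\rho_1,\ldots,\rho_{m+2}$ by $\rho_{m+2}=0$, $\rho_{m+1}=1$, $\rho_k=u_k\rho_{k+1}+\rho_{k+2}$ for $1\le k\le m$. For $m\ge1$, $\rho_1/\rho_2$ is the simple continued fraction $[u_1,\ldots,u_m]$ in lowest terms; $\rho_1$ and $\rho_2$ are called its reduced numerator and denominator. For the empty sequence ($m=0$) the reduced numerator and denominator are taken to be $\rho_1=1$, $\rho_2=0$. "The Euclidean algorithm with $n$ and $a$ produces quotients $(u_1,\ldots,u_m)$" means $n=\rho_1$, $a=\rho_2$ for that sequence; this is the ordinary Euclidean algorithm except that the last quotient may be $1$ (convention: an ordinary final step $r_l=q_l\cdot1+0$ may be rewritten as $r_l=(q_l-1)\cdot1+1$, $1=1\cdot1+0$). Here the quotient sequence has length $2s$, with $u_k=u_{2s+1-k}=q_k$ for $1\le k\le s$. -}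

module Defs where

open import Data.Nat using (ℕ; zero; suc; _+_; _*_)
open import Data.List using (List; []; _∷_)
open import Data.Product using (_×_; _,_; proj₁; proj₂)
open import Relation.Binary.PropositionalEquality using (_≡_)

-- Generalized Euclidean recursion: for (u₁,…,u_m) returns (ρ₁ , ρ₂) where
-- ρ_{m+2} = 0, ρ_{m+1} = 1, ρ_k = u_k ρ_{k+1} + ρ_{k+2}.
rho : List ℕ → ℕ × ℕ
rho []       = 1 , 0
rho (u ∷ us) with rho us
... | p , q = u * p + q , p

redNum : List ℕ → ℕ
redNum us = proj₁ (rho us)

redDen : List ℕ → ℕ
redDen us = proj₂ (rho us)

EuclidProduces : ℕ → ℕ → List ℕ → Set
EuclidProduces n a us = (redNum us ≡ n) × (redDen us ≡ a)

-- The continued fraction [u₁,…,u_m] has the matrix M = ∏ [[uₖ,1],[1,0]], whose first column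
-- is (ρ₁ , ρ₂) and whose determinant is ±1.  Reversing the quotients transposes M, so for the
-- palindrome P = [q₂,…,q_s,q_s,…,q₂] the matrix is X Xᵀ = [[A,B],[B,D]] with AD = B² + 1
-- (Brahmagupta's identity); positivity of q₂ gives D ≤ A, hence B < A.  The whole quotient
-- sequence is q₁ ∷ P ∷ʳ q₁, which gives a = B + q₁A and n = q₁a + q₁B + D; hence a² + 1 = An,
-- redNum P = A and redDen P = B = a mod A.
module Submission where

open import Defs
open import Data.Nat using (ℕ; _+_; _*_; _≥_; _>_; _≤_; _<_; NonZero; z<s)
open import Data.Nat.Base using (>-nonZero)
open import Data.Nat.DivMod using (_%_; m<n⇒m%n≡m; [m+kn]%n≡m%n)
open import Data.Nat.Coprimality using (Coprime)
open import Data.Nat.Properties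
open import Data.Nat.Tactic.RingSolver using (solve-∀; solve)
open import Data.List using (List; []; _∷_; _++_; reverse; length)
open import Data.List.Properties using (++-assoc; ++-identityʳ; unfold-reverse)
open import Data.List.Relation.Unary.All as All using (All)
open import Data.Product using (Σ; ∃-syntax; _×_; _,_; proj₁; proj₂)
open import Data.Sum using (_⊎_; inj₁; inj₂; swap)
open import Relation.Binary.PropositionalEquality
  using (_≡_; refl; sym; trans; cong; cong₂; subst; subst₂; module ≡-Reasoning)

open ≡-Reasoning

record Mat : Set where
  constructor mat
  field
    e₁₁ e₁₂ e₂₁ e₂₂ : ℕ

mat-cong : ∀ {a b c d a′ b′ c′ d′} → a ≡ a′ → b ≡ b′ → c ≡ c′ → d ≡ d′ →
           mat a b c d ≡ mat a′ b′ c′ d′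
mat-cong refl refl refl refl = refl

I : Mat
I = mat 1 0 0 1

infixl 7 _⊗_
_⊗_ : Mat → Mat → Mat
mat a b c d ⊗ mat e f g h = mat (a * e + b * g) (a * f + b * h) (c * e + d * g) (c * f + d * h)

_ᵀ : Mat → Mat
mat a b c d ᵀ = mat a c b d

infixr 5 _▷_
_▷_ : Mat → ℕ × ℕ → ℕ × ℕ
mat a b c d ▷ (x , y) = a * x + b * y , c * x + d * y

⊗-identityˡ : ∀ X → I ⊗ X ≡ X
⊗-identityˡ (mat a b c d) =
  mat-cong (solve (a ∷ c ∷ [])) (solve (b ∷ d ∷ [])) (solve (a ∷ c ∷ [])) (solve (b ∷ d ∷ []))

⊗-identityʳ : ∀ X → X ⊗ I ≡ X
⊗-identityʳ (mat a b c d) =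
  mat-cong (solve (a ∷ b ∷ [])) (solve (a ∷ b ∷ [])) (solve (c ∷ d ∷ [])) (solve (c ∷ d ∷ []))

⊗-entry-assoc : ∀ a b e f g h x y →
  (a * e + b * g) * x + (a * f + b * h) * y ≡ a * (e * x + f * y) + b * (g * x + h * y)
⊗-entry-assoc = solve-∀

⊗-assoc : ∀ X Y Z → X ⊗ Y ⊗ Z ≡ X ⊗ (Y ⊗ Z)
⊗-assoc (mat a b c d) (mat e f g h) (mat i j k l) =
  mat-cong (⊗-entry-assoc a b e f g h i k) (⊗-entry-assoc a b e f g h j l)
           (⊗-entry-assoc c d e f g h i k) (⊗-entry-assoc c d e f g h j l)

⊗-▷ : ∀ X Y v → (X ⊗ Y) ▷ v ≡ X ▷ Y ▷ v
⊗-▷ (mat a b c d) (mat e f g h) (x , y) =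
  cong₂ _,_ (⊗-entry-assoc a b e f g h x y) (⊗-entry-assoc c d e f g h x y)

ᵀ-⊗ : ∀ X Y → (X ⊗ Y) ᵀ ≡ Y ᵀ ⊗ X ᵀ
ᵀ-⊗ (mat a b c d) (mat e f g h) =
  mat-cong (entry a b e g) (entry c d e g) (entry a b f h) (entry c d f h)
  where
  entry : ∀ a b e g → a * e + b * g ≡ e * a + g * b
  entry = solve-∀

I-▷ : ∀ v → I ▷ v ≡ v
I-▷ (x , y) = cong₂ _,_ (solve (x ∷ y ∷ [])) (solve (x ∷ y ∷ []))

step : ℕ → Mat
step u = mat u 1 1 0

cfMat : List ℕ → Mat
cfMat []       = I
cfMat (u ∷ us) = step u ⊗ cfMat us

rho-∷ : ∀ u us → rho (u ∷ us) ≡ step u ▷ rho us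
rho-∷ u us with rho us
... | p , q = cong₂ _,_ (solve (u ∷ p ∷ q ∷ [])) (solve (p ∷ q ∷ []))

rho-++ : ∀ us vs → rho (us ++ vs) ≡ cfMat us ▷ rho vs
rho-++ []       vs = sym (I-▷ (rho vs))
rho-++ (u ∷ us) vs = begin
  rho (u ∷ us ++ vs)          ≡⟨ rho-∷ u (us ++ vs) ⟩
  step u ▷ rho (us ++ vs)     ≡⟨ cong (step u ▷_) (rho-++ us vs) ⟩
  step u ▷ cfMat us ▷ rho vs  ≡⟨ ⊗-▷ (step u) (cfMat us) (rho vs) ⟨
  cfMat (u ∷ us) ▷ rho vs     ∎

rho-cfMat : ∀ us → rho us ≡ cfMat us ▷ (1 , 0)
rho-cfMat us = trans (cong rho (sym (++-identityʳ us))) (rho-++ us [])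

cfMat-++ : ∀ us vs → cfMat (us ++ vs) ≡ cfMat us ⊗ cfMat vs
cfMat-++ []       vs = sym (⊗-identityˡ (cfMat vs))
cfMat-++ (u ∷ us) vs = begin
  step u ⊗ cfMat (us ++ vs)         ≡⟨ cong (step u ⊗_) (cfMat-++ us vs) ⟩
  step u ⊗ (cfMat us ⊗ cfMat vs)    ≡⟨ ⊗-assoc (step u) (cfMat us) (cfMat vs) ⟨
  step u ⊗ cfMat us ⊗ cfMat vs      ∎

cfMat-reverse : ∀ us → cfMat (reverse us) ≡ cfMat us ᵀ
cfMat-reverse []       = refl
cfMat-reverse (u ∷ us) = begin
  cfMat (reverse (u ∷ us))          ≡⟨ cong cfMat (unfold-reverse u us) ⟩
  cfMat (reverse us ++ u ∷ [])      ≡⟨ cfMat-++ (reverse us) (u ∷ []) ⟩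
  cfMat (reverse us) ⊗ (step u ⊗ I) ≡⟨ cong₂ _⊗_ (cfMat-reverse us) (⊗-identityʳ (step u)) ⟩
  cfMat us ᵀ ⊗ step u ᵀ             ≡⟨ ᵀ-⊗ (step u) (cfMat us) ⟨
  cfMat (u ∷ us) ᵀ                  ∎

cfMat-palindrome : ∀ us → cfMat (us ++ reverse us) ≡ cfMat us ⊗ cfMat us ᵀ
cfMat-palindrome us = trans (cfMat-++ us (reverse us)) (cong (cfMat us ⊗_) (cfMat-reverse us))

OneApart : ℕ → ℕ → Set
OneApart x y = x ≡ y + 1 ⊎ y ≡ x + 1

OneApart-+ : ∀ k {x y} → OneApart x y → OneApart (k + x) (k + y)
OneApart-+ k (inj₁ x≡y+1) = inj₁ (trans (cong (k +_) x≡y+1) (sym (+-assoc k _ 1)))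
OneApart-+ k (inj₂ y≡x+1) = inj₂ (trans (cong (k +_) y≡x+1) (sym (+-assoc k _ 1)))

OneApart-squares : ∀ {x y} → OneApart x y → x * x + y * y ≡ 2 * x * y + 1
OneApart-squares {y = y} (inj₁ refl) = solve (y ∷ [])
OneApart-squares {x = x} (inj₂ refl) = solve (x ∷ [])

-- determinant ±1, phrased without subtraction
Unimodular : Mat → Set
Unimodular (mat a b c d) = OneApart (a * d) (b * c)

step-⊗-unimodular : ∀ u X → Unimodular X → Unimodular (step u ⊗ X)
step-⊗-unimodular u (mat a b c d) det =
  subst₂ OneApart ad′ bc′ (OneApart-+ (u * a * b) (swap det))
  where
  ad′ : u * a * b + b * c ≡ (u * a + 1 * c) * (1 * b + 0 * d)
  ad′ = solve (u ∷ a ∷ b ∷ c ∷ d ∷ [])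
  bc′ : u * a * b + a * d ≡ (u * b + 1 * d) * (1 * a + 0 * c)
  bc′ = solve (u ∷ a ∷ b ∷ c ∷ d ∷ [])

cfMat-unimodular : ∀ us → Unimodular (cfMat us)
cfMat-unimodular []       = inj₁ refl
cfMat-unimodular (u ∷ us) = step-⊗-unimodular u (cfMat us) (cfMat-unimodular us)

brahmagupta : ∀ a b c d → OneApart (a * d) (b * c) →
  (a * a + b * b) * (c * c + d * d) ≡ (a * c + b * d) * (a * c + b * d) + 1
brahmagupta a b c d det = begin
  (a * a + b * b) * (c * c + d * d)
    ≡⟨ solve (a ∷ b ∷ c ∷ d ∷ []) ⟩
  (a * c) * (a * c) + (b * d) * (b * d) + ((a * d) * (a * d) + (b * c) * (b * c))
    ≡⟨ cong ((a * c) * (a * c) + (b * d) * (b * d) +_) (OneApart-squares det) ⟩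
  (a * c) * (a * c) + (b * d) * (b * d) + (2 * (a * d) * (b * c) + 1)
    ≡⟨ solve (a ∷ b ∷ c ∷ d ∷ []) ⟩
  (a * c + b * d) * (a * c + b * d) + 1 ∎

ShortSecondRow : Mat → Set
ShortSecondRow (mat a b c d) = c * c + d * d ≤ a * a + b * b

step-⊗-shortSecondRow : ∀ {u} X → u > 0 → ShortSecondRow (step u ⊗ X)
step-⊗-shortSecondRow {u} (mat a b c d) u>0 =
  subst₂ _≤_ second first
    (+-mono-≤ (*-mono-≤ (≤-dominant a c) (≤-dominant a c)) (*-mono-≤ (≤-dominant b d) (≤-dominant b d)))
  where
  second : a * a + b * b ≡ (1 * a + 0 * c) * (1 * a + 0 * c) + (1 * b + 0 * d) * (1 * b + 0 * d)
  second = solve (a ∷ b ∷ c ∷ d ∷ [])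
  first : (u * a + c) * (u * a + c) + (u * b + d) * (u * b + d)
        ≡ (u * a + 1 * c) * (u * a + 1 * c) + (u * b + 1 * d) * (u * b + 1 * d)
  first = solve (u ∷ a ∷ b ∷ c ∷ d ∷ [])
  ≤-dominant : ∀ x y → x ≤ u * x + y
  ≤-dominant x y = ≤-trans (m≤n*m x u ⦃ >-nonZero u>0 ⦄) (m≤m+n (u * x) y)

cfMat-shortSecondRow : ∀ us → All (_> 0) us → ShortSecondRow (cfMat us)
cfMat-shortSecondRow []       All.[]          = ≤-refl
cfMat-shortSecondRow (u ∷ us) (u>0 All.∷ _)  = step-⊗-shortSecondRow (cfMat us) u>0

⊗ᵀ-symmetric : ∀ X → Unimodular X → ShortSecondRow X →
  ∃[ A ] ∃[ B ] ∃[ D ] X ⊗ X ᵀ ≡ mat A B B D × A * D ≡ B * B + 1 × D ≤ A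
⊗ᵀ-symmetric (mat a b c d) det short =
  _ , _ , _ , mat-cong refl refl (cong₂ _+_ (*-comm c a) (*-comm d b)) refl ,
  brahmagupta a b c d det , short

m*o≡n*n+1⇒n<m : ∀ {m n o} → m * o ≡ n * n + 1 → o ≤ m → n < m
m*o≡n*n+1⇒n<m {m} {n} {o} mo≡nn+1 o≤m = ≰⇒> λ m≤n → <⇒≱ nn<mm (*-mono-≤ m≤n m≤n)
  where
  nn<mm : n * n < m * m
  nn<mm = <-≤-trans (subst (n * n <_) (sym mo≡nn+1) (m<m+n (n * n) z<s)) (*-monoʳ-≤ m o≤m)

++-reverse-∷ : ∀ {A : Set} (x : A) xs → (x ∷ xs) ++ reverse (x ∷ xs) ≡ x ∷ (xs ++ reverse xs) ++ x ∷ []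
++-reverse-∷ x xs =
  cong (x ∷_) (trans (cong (xs ++_) (unfold-reverse x xs)) (sym (++-assoc xs (reverse xs) (x ∷ []))))

Corollary1Conclusion : ℕ → ℕ → List ℕ → Set
Corollary1Conclusion n a P = Σ ℕ (λ k → Σ (NonZero k) (λ nz →
    (a * a + 1 ≡ k * n)
    × (redNum P ≡ k)
    × (redDen P ≡ _%_ a k ⦃ nz ⦄)))

wrapped-symmetric : ∀ {n a} q P {A B D} → cfMat P ≡ mat A B B D → A * D ≡ B * B + 1 → D ≤ A →
  EuclidProduces n a (q ∷ P ++ q ∷ []) → Corollary1Conclusion n a P
wrapped-symmetric {n} {a} q P {A} {B} {D} P≡ AD≡BB+1 D≤A (num≡n , den≡a) =
  A , A≢0 , aa+1≡An , cong proj₁ rhoP , trans (cong proj₂ rhoP) B≡a%A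
  where
  B<A : B < A
  B<A = m*o≡n*n+1⇒n<m AD≡BB+1 D≤A

  instance
    A≢0 : NonZero A
    A≢0 = >-nonZero (m<n⇒0<n B<A)

  rhoP : rho P ≡ (A , B)
  rhoP = begin
    rho P                   ≡⟨ rho-cfMat P ⟩
    cfMat P ▷ (1 , 0)       ≡⟨ cong (_▷ (1 , 0)) P≡ ⟩
    mat A B B D ▷ (1 , 0)   ≡⟨ cong₂ _,_ (solve (A ∷ B ∷ [])) (solve (B ∷ D ∷ [])) ⟩
    (A , B)                 ∎

  rhoWrapped : rho (q ∷ P ++ q ∷ []) ≡ (q * (B + q * A) + (q * B + D) , B + q * A)
  rhoWrapped = begin
    rho (q ∷ P ++ q ∷ [])                     ≡⟨ rho-∷ q (P ++ q ∷ []) ⟩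
    step q ▷ rho (P ++ q ∷ [])                ≡⟨ cong (step q ▷_) (rho-++ P (q ∷ [])) ⟩
    step q ▷ cfMat P ▷ rho (q ∷ [])           ≡⟨ cong (λ M → step q ▷ M ▷ rho (q ∷ [])) P≡ ⟩
    step q ▷ mat A B B D ▷ rho (q ∷ [])       ≡⟨ cong₂ _,_ num den ⟩
    (q * (B + q * A) + (q * B + D) , B + q * A) ∎
    where
    num : q * (A * (q * 1 + 0) + B * 1) + 1 * (B * (q * 1 + 0) + D * 1) ≡ q * (B + q * A) + (q * B + D)
    num = solve (q ∷ A ∷ B ∷ D ∷ [])
    den : 1 * (A * (q * 1 + 0) + B * 1) + 0 * (B * (q * 1 + 0) + D * 1) ≡ B + q * A
    den = solve (q ∷ A ∷ B ∷ D ∷ [])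

  n≡ : n ≡ q * (B + q * A) + (q * B + D)
  n≡ = trans (sym num≡n) (cong proj₁ rhoWrapped)

  a≡ : a ≡ B + q * A
  a≡ = trans (sym den≡a) (cong proj₂ rhoWrapped)

  aa+1≡An : a * a + 1 ≡ A * n
  aa+1≡An = begin
    a * a + 1                                 ≡⟨ cong (λ x → x * x + 1) a≡ ⟩
    (B + q * A) * (B + q * A) + 1             ≡⟨ solve (q ∷ A ∷ B ∷ []) ⟩
    A * (q * (B + q * A) + q * B) + (B * B + 1) ≡⟨ cong (A * (q * (B + q * A) + q * B) +_) AD≡BB+1 ⟨
    A * (q * (B + q * A) + q * B) + A * D     ≡⟨ solve (q ∷ A ∷ B ∷ D ∷ []) ⟩
    A * (q * (B + q * A) + (q * B + D))       ≡⟨ cong (A *_) n≡ ⟨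
    A * n                                     ∎

  B≡a%A : B ≡ a % A
  B≡a%A = begin
    B                 ≡⟨ m<n⇒m%n≡m B<A ⟨
    B % A             ≡⟨ [m+kn]%n≡m%n B q A ⟨
    (B + q * A) % A   ≡⟨ cong (_% A) a≡ ⟨
    a % A             ∎

corollary1 : (n a s : ℕ) → n > 0 → a > 0 → Coprime n a → s ≥ 1 →
    (q₁ : ℕ) (qs : List ℕ) → length (q₁ ∷ qs) ≡ s → All (λ q → q > 0) (q₁ ∷ qs) →
    EuclidProduces n a ((q₁ ∷ qs) ++ reverse (q₁ ∷ qs)) →
    Σ ℕ (λ k → Σ (NonZero k) (λ nz →
    (a * a + 1 ≡ k * n)
    × (redNum (qs ++ reverse qs) ≡ k)
    × (redDen (qs ++ reverse qs) ≡ _%_ a k ⦃ nz ⦄)))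
corollary1 n a _ _ _ _ _ q qs _ (_ All.∷ qs>0) euclid =
  let A , B , D , XXᵀ≡ , AD≡BB+1 , D≤A =
        ⊗ᵀ-symmetric (cfMat qs) (cfMat-unimodular qs) (cfMat-shortSecondRow qs qs>0)
  in wrapped-symmetric q (qs ++ reverse qs) (trans (cfMat-palindrome qs) XXᵀ≡) AD≡BB+1 D≤A
       (subst (EuclidProduces n a) (++-reverse-∷ q qs) euclid)
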